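{- Let $\mathbf{P}=(X,P)$ be a finite interval order, and let $\mathbf{I}$ be a distinguishing interval representation of $\mathbf{P}$ in which every interval has length $1$ except for one interval, whose length lies in $[0,2]$. Then $\dim(\mathbf{P})\le 3$.
   Context: An interval representation of a poset $(X,P)$ assigns to each $x\in X$ a closed real interval $[l_x,r_x]$ such that $x<y$ in $P$ iff $r_x<l_y$. It is distinguishing if no two intervals share an endpoint. The dimension $\dim(\mathbf{P})$ is the minimum number of linear extensions of $P$ whose intersection is $P$.
   Formalization: The endpoints of the intervals in the distinguishing representation are rational rather than real. -}

module Defs where

open import Data.Nat using (ℕ; _≤_)
open import Data.Fin using (Fin)
import Data.Fin as F
open import Data.Fin.Permutation using (Permutation′; _⟨$⟩ʳ_)
open import Data.Rational using (ℚ; _<_; _-_; 0ℚ; 1ℚ)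
import Data.Rational as Q
open import Data.Product using (Σ; _×_; ∃)
open import Data.Vec using (Vec; lookup)
open import Function.Bundles using (_⇔_)
open import Relation.Binary.PropositionalEquality using (_≡_; _≢_)

-- Ground set X = Fin n.  An interval representation: x ↦ [l x , r x].
-- The poset P induced by the representation: x < y in P iff r x < l y.
IntervalOrder : {n : ℕ} → (Fin n → ℚ) → (Fin n → ℚ) → Fin n → Fin n → Set
IntervalOrder l r x y = r x < l y

Distinguishing : {n : ℕ} → (Fin n → ℚ) → (Fin n → ℚ) → Set
Distinguishing {n} l r = ∀ (x y : Fin n) → x ≢ y →
  (l x ≢ l y) × (r x ≢ r y) × (l x ≢ r y)

-- A linear extension of a strict order _≺_ on Fin n, encoded as a
-- ranking permutation σ (x comes before y iff σ x < σ y).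
LinearExtension : (n : ℕ) → (Fin n → Fin n → Set) → Set
LinearExtension n _≺_ =
  Σ (Permutation′ n) λ σ → ∀ x y → x ≺ y → (σ ⟨$⟩ʳ x) F.< (σ ⟨$⟩ʳ y)

Realizer : (n : ℕ) → (Fin n → Fin n → Set) → ℕ → Set
Realizer n _≺_ d =
  Σ (Vec (LinearExtension n _≺_) d) λ Ls →
    ∀ x y → (x ≺ y) ⇔ (∀ i → (Data.Product.proj₁ (lookup Ls i) ⟨$⟩ʳ x) F.< (Data.Product.proj₁ (lookup Ls i) ⟨$⟩ʳ y))

DimLE : (n : ℕ) → (Fin n → Fin n → Set) → ℕ → Set
DimLE n _≺_ d = ∃ λ k → k ≤ d × Realizer n _≺_ k

{-# OPTIONS --safe #-}

-- Measure positions from l j and give each unit interval the cell (a , f) of its left end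
-- a + f, with a ∈ ℤ and 0 ≤ f < 1; the long interval becomes [0 , len] with 0 ≤ len ≤ 2.
-- Two unit intervals are incomparable iff they start in the same or in adjacent blocks a
-- (with fractional parts in the right order), so three lexicographic keys in ℤ × ℚ realize
-- the order: L₁ sorts by block and by decreasing f within a block, while L₂ and L₃ merge the
-- blocks in pairs {2m - 1, 2m} resp. {2m, 2m + 1} and sort by increasing f within a pair;
-- any two incomparable unit intervals are then reversed between L₁ and one of L₂, L₃.
-- The long interval goes just before block -1 in L₁, and in L₂ and L₃ it is keyed like a
-- unit interval starting at its right end len, i.e. at the cells (0 , len) and (1 , len - 1);
-- because len ≤ 2 this reverses it against every interval it overlaps.

module Submission where

open import Defs
open import Data.Nat using (ℕ)
open import Data.Fin using (Fin)
open import Data.Rational using (ℚ; _≤_; _-_; 0ℚ; 1ℚ)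
open import Data.Product using (_×_)
open import Relation.Binary.PropositionalEquality using (_≡_; _≢_)

open import Data.Bool.Base using (if_then_else_)
open import Data.Fin as Fin using (zero; suc; fromℕ<; punchOut)
import Data.Fin.Properties as Finₚ
open import Data.Fin.Permutation using (Permutation′; _⟨$⟩ʳ_)
open import Data.Fin.Subset using (Subset; inside; outside; ⊤; _∈_; _∉_; _⊂_; ∣_∣)
open import Data.Fin.Subset.Properties using (∈⊤; ∣⊤∣≡n; p⊂q⇒∣p∣<∣q∣)
open import Data.Integer using (ℤ; +_; -[1+_]; 0ℤ; 1ℤ; -1ℤ)
import Data.Integer as ℤ
open import Data.Integer.DivMod using (a≡a%n+[a/n]*n; n%d<d)
import Data.Integer.Properties as ℤₚ
import Data.Nat as ℕ
import Data.Nat.Properties as ℕₚ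
open import Data.Product using (_,_; proj₁; proj₂; ∃)
open import Data.Product.Relation.Binary.Lex.Strict using (×-strictTotalOrder)
open import Data.Rational using (floor; ↥_; ↧_)
import Data.Rational as ℚ
open import Data.Rational.Literals using (fromℤ)
import Data.Rational.Properties as ℚₚ
import Data.Rational.Solver as ℚ-Solver
import Data.Rational.Unnormalised as ℚᵘ
import Data.Rational.Unnormalised.Properties as ℚᵘₚ
open import Data.Sum using (_⊎_; inj₁; inj₂)
import Data.Sum as Sum
open import Data.Vec using (Vec; tabulate; lookup)
open import Data.Vec.Properties using (lookup∘tabulate; lookup⇒[]=; []=⇒lookup)
open import Function.Base using (_∘_)
open import Function.Bundles using (mk⤖; mk⇔)
open import Function.Consequences.Propositional using (strictlySurjective⇒surjective)
open import Function.Definitions using (Injective; StrictlySurjective)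
open import Function.Properties.Bijection using (⤖⇒↔)
open import Relation.Binary.Bundles using (StrictTotalOrder)
open import Relation.Binary.Definitions using (tri<; tri≈; tri>)
open import Relation.Binary.PropositionalEquality
  using (refl; sym; trans; cong; subst; subst₂; module ≡-Reasoning)
open import Relation.Nullary using (yes; no; does; contradiction)
open import Relation.Nullary.Decidable using (dec-true)

injective⇒strictlySurjective : ∀ {n} {f : Fin n → Fin n} →
                               Injective _≡_ _≡_ f → StrictlySurjective _≡_ f
injective⇒strictlySurjective {ℕ.suc m} {f} f-injective y with Finₚ.any? (λ x → f x Finₚ.≟ y)
... | yes hit = hit
... | no miss = contradiction (Finₚ.injective⇒≤ punchOut∘f-injective) ℕₚ.1+n≰n
  where
  y≢f : ∀ x → y ≢ f x
  y≢f x y≡fx = miss (x , sym y≡fx)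

  punchOut∘f-injective : Injective _≡_ _≡_ (λ x → punchOut (y≢f x))
  punchOut∘f-injective eq = f-injective (Finₚ.punchOut-injective (y≢f _) (y≢f _) eq)

module Ranking {a ℓ₁ ℓ₂} (T : StrictTotalOrder a ℓ₁ ℓ₂) {n : ℕ}
               (emb : Fin n → StrictTotalOrder.Carrier T)
               (emb-injective : ∀ {x y} → StrictTotalOrder._≈_ T (emb x) (emb y) → x ≡ y) where

  open StrictTotalOrder T using (_<_; _<?_; compare; irrefl; module Eq) renaming (trans to <-trans)

  below : Fin n → Subset n
  below x = tabulate λ z → if does (emb z <? emb x) then inside else outside

  ∈below⁺ : ∀ {x z} → emb z < emb x → z ∈ below x
  ∈below⁺ {x} {z} z<x = lookup⇒[]= z (below x)
    (trans (lookup∘tabulate _ z) (cong (if_then inside else outside) (dec-true (emb z <? emb x) z<x)))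

  ∈below⁻ : ∀ {x z} → z ∈ below x → emb z < emb x
  ∈below⁻ {x} {z} z∈ with emb z <? emb x | trans (sym (lookup∘tabulate _ z)) ([]=⇒lookup z∈)
  ... | yes z<x | _ = z<x
  ... | no _    | ()

  ∉below-self : ∀ x → x ∉ below x
  ∉below-self x x∈ = irrefl Eq.refl (∈below⁻ x∈)

  rank<n : ∀ x → ∣ below x ∣ ℕ.< n
  rank<n x = subst (∣ below x ∣ ℕ.<_) (∣⊤∣≡n n)
                   (p⊂q⇒∣p∣<∣q∣ ((λ _ → ∈⊤) , x , ∈⊤ , ∉below-self x))

  below-mono : ∀ {x y} → emb x < emb y → below x ⊂ below y
  below-mono {x} x<y = (λ z∈ → ∈below⁺ (<-trans (∈below⁻ z∈) x<y)) , x , ∈below⁺ x<y , ∉below-self x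

  rank : Fin n → Fin n
  rank x = fromℕ< (rank<n x)

  rank-mono : ∀ {x y} → emb x < emb y → rank x Fin.< rank y
  rank-mono {x} {y} x<y = subst₂ ℕ._<_ (sym (Finₚ.toℕ-fromℕ< (rank<n x))) (sym (Finₚ.toℕ-fromℕ< (rank<n y)))
                                 (p⊂q⇒∣p∣<∣q∣ (below-mono x<y))

  rank-injective : Injective _≡_ _≡_ rank
  rank-injective {x} {y} rx≡ry with compare (emb x) (emb y)
  ... | tri< x<y _ _ = contradiction rx≡ry (Finₚ.<⇒≢ (rank-mono x<y))
  ... | tri≈ _ x≈y _ = emb-injective x≈y
  ... | tri> _ _ y<x = contradiction (sym rx≡ry) (Finₚ.<⇒≢ (rank-mono y<x))

  rankPermutation : Permutation′ n
  rankPermutation = ⤖⇒↔ (mk⤖ (rank-injective ,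
    strictlySurjective⇒surjective (injective⇒strictlySurjective rank-injective)))

module _ {a ℓ₁ ℓ₂} (S : StrictTotalOrder a ℓ₁ ℓ₂) {n d : ℕ} {_≺_ : Fin n → Fin n → Set}
         (key : Fin (ℕ.suc d) → Fin n → StrictTotalOrder.Carrier S) where

  open StrictTotalOrder S using (_<_)

  private
    module Rankingᵢ (i : Fin (ℕ.suc d)) =
      Ranking (×-strictTotalOrder S (Finₚ.<-strictTotalOrder n)) (λ x → key i x , x) proj₂

  -- Opaque because unfolding the permutation makes checking keyRealizer blow up.
  opaque
    keyPermutation : Fin (ℕ.suc d) → Permutation′ n
    keyPermutation i = Rankingᵢ.rankPermutation i

    keyPermutation-mono : ∀ i {x y} → key i x < key i y →
                          keyPermutation i ⟨$⟩ʳ x Fin.< keyPermutation i ⟨$⟩ʳ y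
    keyPermutation-mono i x<y = Rankingᵢ.rank-mono i (inj₁ x<y)

  keyRealizer : (∀ i {x y} → x ≺ y → key i x < key i y) →
                (∀ x y → x ≢ y → x ≺ y ⊎ ∃ λ i → key i y < key i x) →
                Realizer n _≺_ (ℕ.suc d)
  keyRealizer key-mono separated = extensions , λ x y → mk⇔ (precedes x y) (realized x y)
    where
    extension : Fin (ℕ.suc d) → LinearExtension n _≺_
    extension i = keyPermutation i , λ x y x≺y → keyPermutation-mono i (key-mono i x≺y)

    extensions : Vec (LinearExtension n _≺_) (ℕ.suc d)
    extensions = tabulate extension

    π : Fin (ℕ.suc d) → Permutation′ n
    π i = proj₁ (lookup extensions i)

    π≡keyPermutation : ∀ i → π i ≡ keyPermutation i
    π≡keyPermutation i = cong proj₁ (lookup∘tabulate extension i)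

    precedes : ∀ x y → x ≺ y → ∀ i → π i ⟨$⟩ʳ x Fin.< π i ⟨$⟩ʳ y
    precedes x y x≺y i = proj₂ (lookup extensions i) x y x≺y

    realized : ∀ x y → (∀ i → π i ⟨$⟩ʳ x Fin.< π i ⟨$⟩ʳ y) → x ≺ y
    realized x y before-in-all with x Finₚ.≟ y
    ... | yes refl = contradiction (before-in-all zero) (Finₚ.<-irrefl refl)
    ... | no x≢y with separated x y x≢y
    ...   | inj₁ x≺y = x≺y
    ...   | inj₂ (i , y<x) = contradiction (keyPermutation-mono i y<x) (Finₚ.<-asym
              (subst (λ σ → σ ⟨$⟩ʳ x Fin.< σ ⟨$⟩ʳ y) (π≡keyPermutation i) (before-in-all i)))

⌊n/2⌋-adjacent : ∀ n → ℕ.⌊ ℕ.suc n /2⌋ ≡ ℕ.⌊ n /2⌋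
                     ⊎ ℕ.⌊ ℕ.suc (ℕ.suc n) /2⌋ ≡ ℕ.⌊ ℕ.suc n /2⌋
⌊n/2⌋-adjacent 0                 = inj₁ refl
⌊n/2⌋-adjacent 1                 = inj₂ refl
⌊n/2⌋-adjacent (ℕ.suc (ℕ.suc n)) = Sum.map (cong ℕ.suc) (cong ℕ.suc) (⌊n/2⌋-adjacent n)

-- ⌊ a / 2 ⌋, rounding towards -∞.
half : ℤ → ℤ
half (+ n)    = + ℕ.⌊ n /2⌋
half -[1+ n ] = -[1+ ℕ.⌊ n /2⌋ ]

half-mono : ∀ {a b} → a ℤ.≤ b → half a ℤ.≤ half b
half-mono (ℤ.-≤- n≤m) = ℤ.-≤- (ℕₚ.⌊n/2⌋-mono n≤m)
half-mono ℤ.-≤+       = ℤ.-≤+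
half-mono (ℤ.+≤+ m≤n) = ℤ.+≤+ (ℕₚ.⌊n/2⌋-mono m≤n)

half-suc-suc : ∀ a → half (ℤ.suc (ℤ.suc a)) ≡ ℤ.suc (half a)
half-suc-suc (+ n)                  = refl
half-suc-suc -[1+ 0 ]               = refl
half-suc-suc -[1+ 1 ]               = refl
half-suc-suc -[1+ ℕ.suc (ℕ.suc n) ] = refl

half-< : ∀ {a b} → ℤ.suc (ℤ.suc a) ℤ.≤ b → half a ℤ.< half b
half-< {a} a+2≤b = ℤₚ.suc[i]≤j⇒i<j (subst (ℤ._≤ _) (half-suc-suc a) (half-mono a+2≤b))

half-adjacent : ∀ a → half (ℤ.suc a) ≡ half a ⊎ half (ℤ.suc (ℤ.suc a)) ≡ half (ℤ.suc a)
half-adjacent (+ n)                  = Sum.map (cong +_) (cong +_) (⌊n/2⌋-adjacent n)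
half-adjacent -[1+ 0 ]               = inj₂ refl
half-adjacent -[1+ 1 ]               = inj₁ refl
half-adjacent -[1+ ℕ.suc (ℕ.suc n) ] =
  Sum.swap (Sum.map (cong -[1+_] ∘ sym) (cong -[1+_] ∘ sym) (⌊n/2⌋-adjacent n))

lexOrder : StrictTotalOrder _ _ _
lexOrder = ×-strictTotalOrder ℤₚ.<-strictTotalOrder ℚₚ.<-strictTotalOrder

infix 4 _<ₗ_
_<ₗ_ : ℤ × ℚ → ℤ × ℚ → Set
_<ₗ_ = StrictTotalOrder._<_ lexOrder

≤×<⇒<ₗ : ∀ {a b f g} → a ℤ.≤ b → f ℚ.< g → (a , f) <ₗ (b , g)
≤×<⇒<ₗ {a} {b} a≤b f<g with a ℤₚ.≟ b
... | yes a≡b = inj₂ (a≡b , f<g)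
... | no a≢b  = inj₁ (ℤₚ.≤∧≢⇒< a≤b a≢b)

unitKey : Fin 3 → ℤ × ℚ → ℤ × ℚ
unitKey zero             (a , f) = a , ℚ.- f
unitKey (suc zero)       (a , f) = half (ℤ.suc a) , f
unitKey (suc (suc zero)) (a , f) = half a , f

longKey : ℚ → Fin 3 → ℤ × ℚ
longKey len zero             = -1ℤ , ℚ.- 1ℚ
longKey len (suc zero)       = 0ℤ , len
longKey len (suc (suc zero)) = 0ℤ , len - 1ℚ

next : ℤ × ℚ → ℤ × ℚ
next (a , f) = ℤ.suc a , f

unitKey-mono : ∀ c d → next c <ₗ d → ∀ i → unitKey i c <ₗ unitKey i d
unitKey-mono _ _ (inj₁ 1+a<b) zero             = inj₁ (ℤₚ.<-trans (ℤₚ.suc[i]≤j⇒i<j ℤₚ.≤-refl) 1+a<b)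
unitKey-mono _ _ (inj₁ 1+a<b) (suc zero)       = inj₁ (half-< (ℤₚ.suc-mono (ℤₚ.i<j⇒suc[i]≤j 1+a<b)))
unitKey-mono _ _ (inj₁ 1+a<b) (suc (suc zero)) = inj₁ (half-< (ℤₚ.i<j⇒suc[i]≤j 1+a<b))
unitKey-mono _       _ (inj₂ (refl , f<g)) zero             = inj₁ (ℤₚ.suc[i]≤j⇒i<j ℤₚ.≤-refl)
unitKey-mono (a , _) _ (inj₂ (refl , f<g)) (suc zero)       =
  ≤×<⇒<ₗ (half-mono (ℤₚ.i≤suc[i] (ℤ.suc a))) f<g
unitKey-mono (a , _) _ (inj₂ (refl , f<g)) (suc (suc zero)) = ≤×<⇒<ₗ (half-mono (ℤₚ.i≤suc[i] a)) f<g

unitKey-separates : ∀ c d → d <ₗ next c → c ≢ d → ∃ λ i → unitKey i d <ₗ unitKey i c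
unitKey-separates (a , f) (b , g) (inj₁ b<1+a) c≢d with ℤₚ.<-cmp b a
... | tri< b<a _ _ = zero , inj₁ b<a
... | tri> _ _ a<b = contradiction (ℤₚ.i<j⇒suc[i]≤j a<b) (ℤₚ.<⇒≱ b<1+a)
... | tri≈ _ refl _ with ℚₚ.<-cmp g f
...   | tri< g<f _ _ = suc zero , inj₂ (refl , g<f)
...   | tri≈ _ g≡f _ = contradiction (cong (a ,_) (sym g≡f)) c≢d
...   | tri> _ _ f<g = zero , inj₂ (refl , ℚₚ.neg-antimono-< f<g)
unitKey-separates (a , _) _ (inj₂ (refl , g<f)) _ with half-adjacent a
... | inj₁ same-block = suc (suc zero) , inj₂ (same-block , g<f)
... | inj₂ same-block = suc zero , inj₂ (same-block , g<f)

Frac : ℚ → Set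
Frac f = 0ℚ ≤ f × f ℚ.< 1ℚ

frac-0 : Frac 0ℚ
frac-0 = ℚₚ.≤-refl , ℚ.*<* (ℤ.+<+ ℕ.z<s)

⟦_⟧ : ℤ × ℚ → ℚ
⟦ a , f ⟧ = fromℤ a ℚ.+ f

fromℤ-mono-≤ : ∀ {a b} → a ℤ.≤ b → fromℤ a ≤ fromℤ b
fromℤ-mono-≤ {a} {b} a≤b =
  ℚ.*≤* (subst₂ ℤ._≤_ (sym (ℤₚ.*-identityʳ a)) (sym (ℤₚ.*-identityʳ b)) a≤b)

fromℤ-suc : ∀ a → fromℤ (ℤ.suc a) ≡ 1ℚ ℚ.+ fromℤ a
fromℤ-suc a = ℚₚ.toℚᵘ-injective (ℚᵘₚ.≃-trans
  (ℚᵘ.*≡* (cong (λ b → (1ℤ ℤ.+ b) ℤ.* + 1) (sym (ℤₚ.*-identityʳ a))))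
  (ℚᵘₚ.≃-sym (ℚₚ.toℚᵘ-homo-+ 1ℚ (fromℤ a))))

⟦next⟧ : ∀ c → ⟦ next c ⟧ ≡ 1ℚ ℚ.+ ⟦ c ⟧
⟦next⟧ (a , f) = trans (cong (ℚ._+ f) (fromℤ-suc a)) (ℚₚ.+-assoc 1ℚ (fromℤ a) f)

fromℤ⌊q⌋≤q : ∀ q → fromℤ (floor q) ≤ q
fromℤ⌊q⌋≤q q@record{} = ℚ.*≤* (subst (floor q ℤ.* ↧ q ℤ.≤_)
  (trans (sym (a≡a%n+[a/n]*n (↥ q) (↧ q))) (sym (ℤₚ.*-identityʳ (↥ q))))
  (ℤₚ.i≤j+i (floor q ℤ.* ↧ q) (+ (↥ q ℤ.% ↧ q))))

q<fromℤ[1+⌊q⌋] : ∀ q → q ℚ.< fromℤ (ℤ.suc (floor q))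
q<fromℤ[1+⌊q⌋] q@record{} = ℚ.*<* (subst₂ ℤ._<_
  (trans (sym (a≡a%n+[a/n]*n (↥ q) (↧ q))) (sym (ℤₚ.*-identityʳ (↥ q))))
  (sym (ℤₚ.suc-* (floor q) (↧ q)))
  (ℤₚ.+-monoˡ-< (floor q ℤ.* ↧ q) (ℤ.+<+ (n%d<d (↥ q) (↧ q)))))

+-cancelˡ-< : ∀ r {p q} → r ℚ.+ p ℚ.< r ℚ.+ q → p ℚ.< q
+-cancelˡ-< r {p} {q} r+p<r+q = subst₂ ℚ._<_ (-r+[r+p]≡p p) (-r+[r+p]≡p q) (ℚₚ.+-monoʳ-< (ℚ.- r) r+p<r+q)
  where
  open ℚ-Solver.+-*-Solver
  -r+[r+p]≡p : ∀ p → ℚ.- r ℚ.+ (r ℚ.+ p) ≡ p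
  -r+[r+p]≡p = solve 2 (λ r p → (:- r) :+ (r :+ p) := p) refl r

cellOf : ℚ → ℤ × ℚ
cellOf q = floor q , q - fromℤ (floor q)

⟦cellOf⟧ : ∀ q → ⟦ cellOf q ⟧ ≡ q
⟦cellOf⟧ q = solve 2 (λ q a → a :+ (q :- a) := q) refl q (fromℤ (floor q))
  where open ℚ-Solver.+-*-Solver

cellOf-frac : ∀ q → Frac (proj₂ (cellOf q))
cellOf-frac q =
  subst (_≤ q - ⌊q⌋) (ℚₚ.+-inverseʳ ⌊q⌋) (ℚₚ.+-monoˡ-≤ (ℚ.- ⌊q⌋) (fromℤ⌊q⌋≤q q)) ,
  subst (q - ⌊q⌋ ℚ.<_) ⌊q⌋+1-⌊q⌋≡1 (ℚₚ.+-monoˡ-< (ℚ.- ⌊q⌋) (q<fromℤ[1+⌊q⌋] q))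
  where
  open ℚ-Solver.+-*-Solver
  ⌊q⌋ : ℚ
  ⌊q⌋ = fromℤ (floor q)

  ⌊q⌋+1-⌊q⌋≡1 : fromℤ (ℤ.suc (floor q)) - ⌊q⌋ ≡ 1ℚ
  ⌊q⌋+1-⌊q⌋≡1 = trans (cong (_- ⌊q⌋) (fromℤ-suc (floor q)))
                      (solve 1 (λ a → (con 1ℚ :+ a) :- a := con 1ℚ) refl ⌊q⌋)

⟦⟧-<⁺ : ∀ c d → Frac (proj₂ c) → Frac (proj₂ d) → c <ₗ d → ⟦ c ⟧ ℚ.< ⟦ d ⟧
⟦⟧-<⁺ (a , f) (b , g) (_ , f<1) (0≤g , _) (inj₁ a<b) = begin-strict
  fromℤ a ℚ.+ f    <⟨ ℚₚ.+-monoʳ-< (fromℤ a) f<1 ⟩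
  fromℤ a ℚ.+ 1ℚ   ≡⟨ trans (ℚₚ.+-comm (fromℤ a) 1ℚ) (sym (fromℤ-suc a)) ⟩
  fromℤ (ℤ.suc a)  ≤⟨ fromℤ-mono-≤ (ℤₚ.i<j⇒suc[i]≤j a<b) ⟩
  fromℤ b          ≡⟨ sym (ℚₚ.+-identityʳ (fromℤ b)) ⟩
  fromℤ b ℚ.+ 0ℚ   ≤⟨ ℚₚ.+-monoʳ-≤ (fromℤ b) 0≤g ⟩
  fromℤ b ℚ.+ g    ∎
  where open ℚₚ.≤-Reasoning
⟦⟧-<⁺ (a , _) _ _ _ (inj₂ (refl , f<g)) = ℚₚ.+-monoʳ-< (fromℤ a) f<g

⟦⟧-<⁻ : ∀ c d → Frac (proj₂ c) → Frac (proj₂ d) → ⟦ c ⟧ ℚ.< ⟦ d ⟧ → c <ₗ d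
⟦⟧-<⁻ c@(a , _) d@(b , _) c-frac d-frac c<d with ℤₚ.<-cmp a b
... | tri< a<b _ _  = inj₁ a<b
... | tri≈ _ refl _ = inj₂ (refl , +-cancelˡ-< (fromℤ a) c<d)
... | tri> _ _ b<a  = contradiction (⟦⟧-<⁺ d c d-frac c-frac (inj₁ b<a)) (ℚₚ.<-asym c<d)

<ₗ[0]⇒< : ∀ {a f b} → 0ℚ ≤ f → (a , f) <ₗ (b , 0ℚ) → a ℤ.< b
<ₗ[0]⇒< _   (inj₁ a<b)       = a<b
<ₗ[0]⇒< 0≤f (inj₂ (_ , f<0)) = contradiction (ℚₚ.≤-<-trans 0≤f f<0) (ℚₚ.<-irrefl refl)

p<r+q⇒p-r<q : ∀ {p q} r → p ℚ.< r ℚ.+ q → p - r ℚ.< q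
p<r+q⇒p-r<q {p} {q} r p<r+q = subst (p - r ℚ.<_) (solve 2 (λ r q → (r :+ q) :- r := q) refl r q)
                                    (ℚₚ.+-monoˡ-< (ℚ.- r) p<r+q)
  where open ℚ-Solver.+-*-Solver

r+p<q⇒p<q-r : ∀ {p q} r → r ℚ.+ p ℚ.< q → p ℚ.< q - r
r+p<q⇒p<q-r {p} {q} r r+p<q = subst (ℚ._< q - r) (solve 2 (λ r p → (r :+ p) :- r := p) refl r p)
                                    (ℚₚ.+-monoˡ-< (ℚ.- r) r+p<q)
  where open ℚ-Solver.+-*-Solver

p-1<p : ∀ p → p - 1ℚ ℚ.< p
p-1<p p = p<r+q⇒p-r<q 1ℚ (subst (ℚ._< 1ℚ ℚ.+ p) (ℚₚ.+-identityˡ p) (ℚₚ.+-monoˡ-< p (proj₂ frac-0)))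

unitKey<longKey : ∀ c len → Frac (proj₂ c) → ⟦ next c ⟧ ℚ.< 0ℚ → ∀ i → unitKey i c <ₗ longKey len i
unitKey<longKey c@(a , f) len c-frac right<0 =
  left-of-block a (<ₗ[0]⇒< (proj₁ c-frac) (⟦⟧-<⁻ (next c) (0ℤ , 0ℚ) c-frac frac-0 right<0))
  where
  left-of-block : ∀ a → ℤ.suc a ℤ.< 0ℤ → ∀ i → unitKey i (a , f) <ₗ longKey len i
  left-of-block (+ _)               (ℤ.+<+ ())
  left-of-block -[1+ 0 ]            (ℤ.+<+ ())
  left-of-block -[1+ ℕ.suc _ ] _ zero             = inj₁ (ℤ.-<- ℕ.z<s)
  left-of-block -[1+ ℕ.suc _ ] _ (suc zero)       = inj₁ ℤ.-<+
  left-of-block -[1+ ℕ.suc _ ] _ (suc (suc zero)) = inj₁ ℤ.-<+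

longKey<unitKey : ∀ d {len} → 0ℚ ≤ len → Frac (proj₂ d) → len ℚ.< ⟦ d ⟧ →
                  ∀ i → longKey len i <ₗ unitKey i d
longKey<unitKey d@(-[1+ _ ] , _) 0≤len d-frac len<d _ =
  contradiction (ℚₚ.≤-<-trans 0≤len len<d)
                (ℚₚ.<-asym (⟦⟧-<⁺ d (0ℤ , 0ℚ) d-frac frac-0 (inj₁ ℤ.-<+)))
longKey<unitKey (+ 0 , _)               _ _ _       zero             = inj₁ ℤ.-<+
longKey<unitKey (+ 0 , g)               _ _ len<g   (suc zero)       =
  inj₂ (refl , subst (_ ℚ.<_) (ℚₚ.+-identityˡ g) len<g)
longKey<unitKey (+ 0 , g) {len}         _ _ len<g   (suc (suc zero)) =
  inj₂ (refl , ℚₚ.<-trans (p-1<p len) (subst (_ ℚ.<_) (ℚₚ.+-identityˡ g) len<g))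
longKey<unitKey (+ 1 , _)               _ _ _       zero             = inj₁ ℤ.-<+
longKey<unitKey (+ 1 , _)               _ _ _       (suc zero)       = inj₁ (ℤ.+<+ ℕ.z<s)
longKey<unitKey (+ 1 , _)               _ _ len<1+g (suc (suc zero)) = inj₂ (refl , p<r+q⇒p-r<q 1ℚ len<1+g)
longKey<unitKey (+ ℕ.suc (ℕ.suc _) , _) _ _ _       zero             = inj₁ ℤ.-<+
longKey<unitKey (+ ℕ.suc (ℕ.suc _) , _) _ _ _       (suc zero)       = inj₁ (ℤ.+<+ ℕ.z<s)
longKey<unitKey (+ ℕ.suc (ℕ.suc _) , _) _ _ _       (suc (suc zero)) = inj₁ (ℤ.+<+ ℕ.z<s)

longKey₀<unitKey₀ : ∀ c len → Frac (proj₂ c) → 0ℚ ℚ.< ⟦ next c ⟧ → longKey len zero <ₗ unitKey zero c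
longKey₀<unitKey₀ (+ _ , _)            _ _         _       = inj₁ ℤ.-<+
longKey₀<unitKey₀ (-[1+ 0 ] , _)       _ (_ , f<1) _       = inj₂ (refl , ℚₚ.neg-antimono-< f<1)
longKey₀<unitKey₀ c@(-[1+ ℕ.suc _ ] , _) _ c-frac  0<right =
  contradiction 0<right (ℚₚ.<-asym (⟦⟧-<⁺ (next c) (0ℤ , 0ℚ) c-frac frac-0 (inj₁ ℤ.-<+)))

longKey-separates : ∀ d {len} → len ≤ 1ℚ ℚ.+ 1ℚ → Frac (proj₂ d) → ⟦ d ⟧ ℚ.< len →
                    ∃ λ i → unitKey i d <ₗ longKey len i
longKey-separates (-[1+ ℕ.suc _ ] , _)   _ _ _       = zero , inj₁ (ℤ.-<- ℕ.z<s)
longKey-separates (-[1+ 0 ] , _)         _ _ _       = suc (suc zero) , inj₁ ℤ.-<+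
longKey-separates (+ 0 , g)              _ _ g<len   =
  suc zero , inj₂ (refl , subst (ℚ._< _) (ℚₚ.+-identityˡ g) g<len)
longKey-separates (+ 1 , _)              _ _ 1+g<len = suc (suc zero) , inj₂ (refl , r+p<q⇒p<q-r 1ℚ 1+g<len)
longKey-separates d@(+ ℕ.suc (ℕ.suc _) , _) len≤2 d-frac d<len
  with <ₗ[0]⇒< (proj₁ d-frac) (⟦⟧-<⁻ d (+ 2 , 0ℚ) d-frac frac-0 (ℚₚ.<-≤-trans d<len len≤2))
... | ℤ.+<+ (ℕ.s<s (ℕ.s<s ()))

module _ {n : ℕ} (l r : Fin n → ℚ) (j : Fin n) (distinct : Distinguishing l r)
         (unit : ∀ x → x ≢ j → r x - l x ≡ 1ℚ)
         (0≤len : 0ℚ ≤ r j - l j) (len≤2 : r j - l j ≤ 1ℚ ℚ.+ 1ℚ) where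

  private
    len : ℚ
    len = r j - l j

    cell : Fin n → ℤ × ℚ
    cell x = cellOf (l x - l j)

    cell-frac : ∀ x → Frac (proj₂ (cell x))
    cell-frac x = cellOf-frac (l x - l j)

    key : Fin 3 → Fin n → ℤ × ℚ
    key i x with x Finₚ.≟ j
    ... | yes _ = longKey len i
    ... | no _  = unitKey i (cell x)

    open ℚ-Solver.+-*-Solver using (solve; _:=_; _:+_; _:-_)

    left≡ : ∀ x → l x ≡ l j ℚ.+ ⟦ cell x ⟧
    left≡ x = trans (solve 2 (λ p c → p := c :+ (p :- c)) refl (l x) (l j))
                    (cong (l j ℚ.+_) (sym (⟦cellOf⟧ (l x - l j))))

    right≡ : ∀ x → x ≢ j → r x ≡ l j ℚ.+ ⟦ next (cell x) ⟧
    right≡ x x≢j = begin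
      r x
        ≡⟨ solve 3 (λ q p c → q := c :+ ((q :- p) :+ (p :- c))) refl (r x) (l x) (l j) ⟩
      l j ℚ.+ ((r x - l x) ℚ.+ (l x - l j))
        ≡⟨ cong (λ u → l j ℚ.+ (u ℚ.+ (l x - l j))) (unit x x≢j) ⟩
      l j ℚ.+ (1ℚ ℚ.+ (l x - l j))
        ≡⟨ cong (λ u → l j ℚ.+ (1ℚ ℚ.+ u)) (sym (⟦cellOf⟧ (l x - l j))) ⟩
      l j ℚ.+ (1ℚ ℚ.+ ⟦ cell x ⟧)
        ≡⟨ cong (l j ℚ.+_) (sym (⟦next⟧ (cell x))) ⟩
      l j ℚ.+ ⟦ next (cell x) ⟧
        ∎
      where open ≡-Reasoning

    left≡-j : l j ≡ l j ℚ.+ 0ℚ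
    left≡-j = sym (ℚₚ.+-identityʳ (l j))

    right≡-j : r j ≡ l j ℚ.+ len
    right≡-j = solve 2 (λ q c → q := c :+ (q :- c)) refl (r j) (l j)

    left-injective : ∀ x y → cell x ≡ cell y → l x ≡ l y
    left-injective x y cx≡cy = trans (left≡ x) (trans (cong (λ c → l j ℚ.+ ⟦ c ⟧) cx≡cy) (sym (left≡ y)))

    shift-< : ∀ {p q p′ q′} → p ≡ l j ℚ.+ p′ → q ≡ l j ℚ.+ q′ → p ℚ.< q → p′ ℚ.< q′
    shift-< p≡ q≡ p<q = +-cancelˡ-< (l j) (subst₂ ℚ._<_ p≡ q≡ p<q)

    key-mono : ∀ i {x y} → IntervalOrder l r x y → key i x <ₗ key i y
    key-mono i {x} {y} rx<ly with x Finₚ.≟ j | y Finₚ.≟ j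
    ... | yes refl | yes refl =
      contradiction (ℚₚ.≤-<-trans 0≤len (shift-< right≡-j left≡-j rx<ly)) (ℚₚ.<-irrefl refl)
    ... | yes refl | no y≢j =
      longKey<unitKey (cell y) 0≤len (cell-frac y) (shift-< right≡-j (left≡ y) rx<ly) i
    ... | no x≢j | yes refl =
      unitKey<longKey (cell x) len (cell-frac x) (shift-< (right≡ x x≢j) left≡-j rx<ly) i
    ... | no x≢j | no y≢j =
      unitKey-mono (cell x) (cell y)
        (⟦⟧-<⁻ (next (cell x)) (cell y) (cell-frac x) (cell-frac y)
               (shift-< (right≡ x x≢j) (left≡ y) rx<ly)) i

    separated : ∀ x y → x ≢ y → IntervalOrder l r x y ⊎ ∃ λ i → key i y <ₗ key i x
    separated x y x≢y with x Finₚ.≟ j | y Finₚ.≟ j | ℚₚ.<-cmp (r x) (l y)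
    ... | _        | _        | tri< rx<ly _ _ = inj₁ rx<ly
    ... | _        | _        | tri≈ _ rx≡ly _ =
      contradiction (sym rx≡ly) (proj₂ (proj₂ (distinct y x (x≢y ∘ sym))))
    ... | yes refl | yes refl | tri> _ _ _     = contradiction refl x≢y
    ... | yes refl | no y≢j   | tri> _ _ ly<rx =
      inj₂ (longKey-separates (cell y) len≤2 (cell-frac y) (shift-< (left≡ y) right≡-j ly<rx))
    ... | no x≢j   | yes refl | tri> _ _ ly<rx =
      inj₂ (zero , longKey₀<unitKey₀ (cell x) len (cell-frac x) (shift-< left≡-j (right≡ x x≢j) ly<rx))
    ... | no x≢j   | no y≢j   | tri> _ _ ly<rx =
      inj₂ (unitKey-separates (cell x) (cell y)
        (⟦⟧-<⁻ (cell y) (next (cell x)) (cell-frac y) (cell-frac x)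
               (shift-< (left≡ y) (right≡ x x≢j) ly<rx))
        (proj₁ (distinct x y x≢y) ∘ left-injective x y))

  intervalRealizer : Realizer n (IntervalOrder l r) 3
  intervalRealizer = keyRealizer lexOrder key key-mono separated

theorem7p1 : (n : ℕ) (l r : Fin n → ℚ) (j : Fin n) →
    Distinguishing l r →
    (∀ x → x ≢ j → r x - l x ≡ 1ℚ) →
    (0ℚ ≤ r j - l j) × (r j - l j ≤ 1ℚ Data.Rational.+ 1ℚ) →
    DimLE n (IntervalOrder l r) 3
theorem7p1 n l r j distinct unit (0≤len , len≤2) =
  3 , ℕₚ.≤-refl , intervalRealizer l r j distinct unit 0≤len len≤2
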